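{- Let $\mathscr{X}=(P,\Theta_P)$ be a div point set with $|P|=5$ satisfying the laws (L1), (L2), (L3) below. Then, among the five sub div point sets $\mathscr{X}|_R$ with $R\subseteq P$, $|R|=4$, the number that are isomorphic to $Conc_4^1$ is $4$, $2$ or $0$, and each of the remaining ones is isomorphic to $Conv_4$.
   Context: A div point set is an ordered pair $(P,\Theta_P)$ where $P$ is a nonempty finite set and $\Theta_P$ is a set with $|\Theta_P|=\binom{|P|}{2}$ such that every $D\in\Theta_P$ is an ordered pair $D=(d,\delta)$ with $d\subseteq P$, $|d|=2$, and $\delta$ a set with exactly two elements (subsets of $P$) with $\bigcup\delta=P\setminus d$ and $\bigcap\delta=\varnothing$; and two elements of $\Theta_P$ are equal iff their first components are equal. Write $\pi_1(D)=d$, $\pi_2(D)=\delta$. For a set $\delta$ of sets and a 2-element set $T\subseteq\bigcup\delta$, $\phi(\delta,T)=1$ if some element of $\delta$ contains $T$, and $\phi(\delta,T)=0$ otherwise (each element of $\delta$ meets $T$ in at most one point). Laws (for every 4-element $R\subseteq P$ and all $D_1,D_2,D_3\in\Theta_P$, with $\phi_i=\phi(\pi_2(D_i),R\setminus\pi_1(D_i))$): (L1) if $\pi_1(D_1)\cup\pi_1(D_2)\cup\pi_1(D_3)=R$ and $|\pi_1(D_1)\cap\pi_1(D_2)\cap\pi_1(D_3)|=1$, then ($\phi_1=0\iff\phi_2=\phi_3$); (L2) under the same hypothesis, ($\phi_1=1\iff\phi_2\neq\phi_3$); (L3) if $D_1,D_2,D_3$ are pairwise distinct, $\pi_1(D_1)\cup\pi_1(D_2)\cup\pi_1(D_3)\subset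 R$ and this union has 3 elements, then ($\phi_1=\phi_2=0\Rightarrow\phi_3=1$). For $S\subseteq P$ with $|S|\geq4$, the sub div point set on $S$ is $\mathscr{X}|_S=(S,\{(d,\{X\cap S:X\in\delta\}):(d,\delta)\in\Theta_P,\ d\subseteq S\})$. Two div point sets $(A,\Theta_A),(B,\Theta_B)$ are isomorphic if there is a bijection $f:A\to B$ with $(f[d],\{f[X]:X\in\delta\})\in\Theta_B$ for every $(d,\delta)\in\Theta_A$. $Conc_4^1=(\{1,2,3,4\},\{(\{1,2\},\{\{3\},\{4\}\}),(\{1,3\},\{\{2\},\{4\}\}),(\{1,4\},\{\{2\},\{3\}\}),(\{2,3\},\{\{1,4\},\varnothing\}),(\{2,4\},\{\{1,3\},\varnothing\}),(\{3,4\},\{\{1,2\},\varnothing\})\})$. $Conv_4=(\{1,2,3,4\},\{(\{1,2\},\{\{3,4\},\varnothing\}),(\{1,3\},\{\{2\},\{4\}\}),(\{1,4\},\{\{2,3\},\varnothing\}),(\{2,3\},\{\{1,4\},\varnothing\}),(\{2,4\},\{\{1\},\{3\}\}),(\{3,4\},\{\{1,2\},\varnothing\})\})$. -}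

module Defs where

open import Data.Bool using (Bool; true; false; _∨_; _∧_)
open import Data.Nat using (ℕ)
open import Data.Nat.Combinatorics using (_C_)
open import Data.Fin using (Fin; #_; _≟_)
open import Data.Fin.Subset
  using (Subset; _∪_; _∩_; _─_; _⊆_; _⊂_; ∣_∣; ⊥; ⊤; ⁅_⁆; Nonempty)
  renaming (_∈_ to _∈ₛ_)
open import Data.Fin.Subset.Properties using (_⊆?_)
open import Data.List using (List; []; _∷_; map; length; filter; foldr; allFin)
open import Data.Bool.ListAction using (any)
open import Data.List.Membership.Propositional using (_∈_)
open import Data.List.Relation.Unary.All using (All)
open import Data.List.Relation.Unary.Unique.Propositional using (Unique)
open import Data.Product using (Σ; ∃; _×_; _,_)
open import Data.Sum using (_⊎_)
open import Data.Vec using (tabulate; lookup)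
open import Function.Bundles using (_⇔_)
open import Relation.Binary.PropositionalEquality using (_≡_; _≢_)
open import Relation.Nullary.Decidable using (⌊_⌋)

-- Finite sets are modelled as subsets of a universe Fin m.
-- An element (d , δ) of Θ_P with δ = {X , Y} is an Entry with fields
-- d, X, Y (the pair {X , Y} is unordered: see _≈δ_ below).

record Entry (m : ℕ) : Set where
  constructor ⟨_∣_,_⟩
  field
    d : Subset m
    X : Subset m
    Y : Subset m
open Entry public

-- A "raw" div point set over the universe Fin m: the carrier P and
-- the finite set Θ_P, listed without repetition (see IsDivPointSet).
record RawDPS (m : ℕ) : Set where
  constructor mkDPS
  field
    P : Subset m
    Θ : List (Entry m)
open RawDPS public

WellFormedEntry : ∀ {m} → Subset m → Entry m → Set
WellFormedEntry P e =
  (d e ⊆ P) × (∣ d e ∣ ≡ 2) × (X e ≢ Y e)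
  × (X e ∪ Y e ≡ P ─ d e) × (X e ∩ Y e ≡ ⊥)

record IsDivPointSet {m} (𝒳 : RawDPS m) : Set where
  field
    nonempty   : Nonempty (P 𝒳)
    entries    : All (WellFormedEntry (P 𝒳)) (Θ 𝒳)
    -- elements of Θ are equal iff their first components are equal
    -- (Θ is listed without repetitions)
    uniqueD    : Unique (map d (Θ 𝒳))
    cardinality : length (Θ 𝒳) ≡ ∣ P 𝒳 ∣ C 2

φ : ∀ {m} → Subset m → Subset m → Subset m → Bool
φ X Y T = ⌊ T ⊆? X ⌋ ∨ ⌊ T ⊆? Y ⌋

φ[_,_] : ∀ {m} → Entry m → Subset m → Bool
φ[ D , R ] = φ (X D) (Y D) (R ─ d D)

L1 : ∀ {m} → RawDPS m → Set
L1 𝒳 = ∀ (R : Subset _) → R ⊆ P 𝒳 → ∣ R ∣ ≡ 4 →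
  ∀ {D₁ D₂ D₃} → D₁ ∈ Θ 𝒳 → D₂ ∈ Θ 𝒳 → D₃ ∈ Θ 𝒳 →
  d D₁ ∪ d D₂ ∪ d D₃ ≡ R → ∣ d D₁ ∩ d D₂ ∩ d D₃ ∣ ≡ 1 →
  (φ[ D₁ , R ] ≡ false) ⇔ (φ[ D₂ , R ] ≡ φ[ D₃ , R ])

L2 : ∀ {m} → RawDPS m → Set
L2 𝒳 = ∀ (R : Subset _) → R ⊆ P 𝒳 → ∣ R ∣ ≡ 4 →
  ∀ {D₁ D₂ D₃} → D₁ ∈ Θ 𝒳 → D₂ ∈ Θ 𝒳 → D₃ ∈ Θ 𝒳 →
  d D₁ ∪ d D₂ ∪ d D₃ ≡ R → ∣ d D₁ ∩ d D₂ ∩ d D₃ ∣ ≡ 1 →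
  (φ[ D₁ , R ] ≡ true) ⇔ (φ[ D₂ , R ] ≢ φ[ D₃ , R ])

L3 : ∀ {m} → RawDPS m → Set
L3 𝒳 = ∀ (R : Subset _) → R ⊆ P 𝒳 → ∣ R ∣ ≡ 4 →
  ∀ {D₁ D₂ D₃} → D₁ ∈ Θ 𝒳 → D₂ ∈ Θ 𝒳 → D₃ ∈ Θ 𝒳 →
  D₁ ≢ D₂ → D₁ ≢ D₃ → D₂ ≢ D₃ →
  d D₁ ∪ d D₂ ∪ d D₃ ⊂ R → ∣ d D₁ ∪ d D₂ ∪ d D₃ ∣ ≡ 3 →
  φ[ D₁ , R ] ≡ false → φ[ D₂ , R ] ≡ false → φ[ D₃ , R ] ≡ true

restrict : ∀ {m} → Subset m → Entry m → Entry m
restrict S ⟨ d ∣ X , Y ⟩ = ⟨ d ∣ X ∩ S , Y ∩ S ⟩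

sub : ∀ {m} → RawDPS m → Subset m → RawDPS m
sub 𝒳 S = mkDPS S (map (restrict S) (filter (λ e → d e ⊆? S) (Θ 𝒳)))

image : ∀ {m k} → (Fin m → Fin k) → Subset m → Subset k
image {m} f A = tabulate λ y →
  any (λ x → lookup A x ∧ ⌊ f x ≟ y ⌋) (allFin m)

-- equality of the two-element sets {X , Y} and {X′ , Y′}
_≈δ_ : ∀ {m} → (Subset m × Subset m) → (Subset m × Subset m) → Set
(X , Y) ≈δ (X′ , Y′) = (X ≡ X′ × Y ≡ Y′) ⊎ (X ≡ Y′ × Y ≡ X′)

-- (d , {X , Y}) ∈ Θ (as an element of the set Θ)
_∈Θ_ : ∀ {m} → Entry m → List (Entry m) → Set
D ∈Θ Θ′ = ∃ λ D′ → D′ ∈ Θ′ × (d D′ ≡ d D) × ((X D′ , Y D′) ≈δ (X D , Y D))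

-- f is a bijection from A onto B (f is given on the whole universe,
-- only its restriction to A matters)
BijectionOnto : ∀ {m k} → (Fin m → Fin k) → Subset m → Subset k → Set
BijectionOnto f A B =
  (∀ {x y} → x ∈ₛ A → y ∈ₛ A → f x ≡ f y → x ≡ y)
  × image f A ≡ B

Isomorphic : ∀ {m k} → RawDPS m → RawDPS k → Set
Isomorphic 𝒜 ℬ = ∃ λ f → BijectionOnto f (P 𝒜) (P ℬ) ×
  All (λ D → ⟨ image f (d D) ∣ image f (X D) , image f (Y D) ⟩ ∈Θ Θ ℬ) (Θ 𝒜)

-- Conc₄¹ and Conv₄ over the universe Fin 4 (point i ↦ # (i - 1))

⟦_⟧ : ∀ {m} → List (Fin m) → Subset m
⟦ xs ⟧ = foldr (λ i s → ⁅ i ⁆ ∪ s) ⊥ xs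

Conc₄¹ : RawDPS 4
Conc₄¹ = mkDPS ⊤
  ( ⟨ ⟦ # 0 ∷ # 1 ∷ [] ⟧ ∣ ⟦ # 2 ∷ [] ⟧ , ⟦ # 3 ∷ [] ⟧ ⟩
  ∷ ⟨ ⟦ # 0 ∷ # 2 ∷ [] ⟧ ∣ ⟦ # 1 ∷ [] ⟧ , ⟦ # 3 ∷ [] ⟧ ⟩
  ∷ ⟨ ⟦ # 0 ∷ # 3 ∷ [] ⟧ ∣ ⟦ # 1 ∷ [] ⟧ , ⟦ # 2 ∷ [] ⟧ ⟩
  ∷ ⟨ ⟦ # 1 ∷ # 2 ∷ [] ⟧ ∣ ⟦ # 0 ∷ # 3 ∷ [] ⟧ , ⊥ ⟩
  ∷ ⟨ ⟦ # 1 ∷ # 3 ∷ [] ⟧ ∣ ⟦ # 0 ∷ # 2 ∷ [] ⟧ , ⊥ ⟩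
  ∷ ⟨ ⟦ # 2 ∷ # 3 ∷ [] ⟧ ∣ ⟦ # 0 ∷ # 1 ∷ [] ⟧ , ⊥ ⟩
  ∷ [] )

Conv₄ : RawDPS 4
Conv₄ = mkDPS ⊤
  ( ⟨ ⟦ # 0 ∷ # 1 ∷ [] ⟧ ∣ ⟦ # 2 ∷ # 3 ∷ [] ⟧ , ⊥ ⟩
  ∷ ⟨ ⟦ # 0 ∷ # 2 ∷ [] ⟧ ∣ ⟦ # 1 ∷ [] ⟧ , ⟦ # 3 ∷ [] ⟧ ⟩
  ∷ ⟨ ⟦ # 0 ∷ # 3 ∷ [] ⟧ ∣ ⟦ # 1 ∷ # 2 ∷ [] ⟧ , ⊥ ⟩
  ∷ ⟨ ⟦ # 1 ∷ # 2 ∷ [] ⟧ ∣ ⟦ # 0 ∷ # 3 ∷ [] ⟧ , ⊥ ⟩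
  ∷ ⟨ ⟦ # 1 ∷ # 3 ∷ [] ⟧ ∣ ⟦ # 0 ∷ [] ⟧ , ⟦ # 2 ∷ [] ⟧ ⟩
  ∷ ⟨ ⟦ # 2 ∷ # 3 ∷ [] ⟧ ∣ ⟦ # 0 ∷ # 1 ∷ [] ⟧ , ⊥ ⟩
  ∷ [] )

-- Since |P| = 5, Θ has exactly one entry θ p for each of the ten pairs p. A 4-subset of P
-- omits one point c, and its sub div point set is determined by the φ-labels of the six pairs
-- inside it, i.e. by a labelling of the edges of a K₄. (L1) says that every vertex of this K₄
-- lies on an even number of labelled edges and (L3) that some edge is labelled, so the
-- labelled edges form a triangle or a 4-cycle. A triangle gives Conc₄¹ and a 4-cycle Conv₄;
-- they are not isomorphic because every entry of Conc₄¹ whose blocks are both nonempty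
-- contains the point 1, whereas in a 4-cycle the two unlabelled edges are disjoint.
-- The number of triangles is even: the labels of all five K₄'s add up, pair by pair, to the
-- labels a pair receives from its three omissions, and these are odd in number for each of
-- the ten pairs; a triangle has three labelled edges and a 4-cycle four.
module Submission where

open import Defs
open import Data.Nat using (ℕ)
open import Data.Fin.Subset using (Subset; _⊆_; ∣_∣)
open import Data.List using (List; length)
open import Data.List.Membership.Propositional using (_∈_; _∉_)
open import Data.List.Relation.Unary.All using (All)
open import Data.List.Relation.Unary.Unique.Propositional using (Unique)
open import Data.Product using (Σ; _×_)
open import Data.Sum using (_⊎_)
open import Function.Bundles using (_⇔_)
open import Relation.Binary.PropositionalEquality using (_≡_)

open import Algebra.Bundles using (CommutativeRing)
open import Data.Bool using (Bool; true; false; _xor_; if_then_else_)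
open import Data.Bool.Properties
  using (xor-same; not-¬; xor-∧-commutativeRing; T-≡; T-∧) renaming (_≟_ to _≟ᵇ_)
open import Data.Fin using (Fin; zero; suc; #_; punchIn; punchOut; opposite; _≟_)
open import Data.Fin.Permutation.Components using (transpose)
open import Data.Fin.Properties using (all?; any?)
open import Data.Fin.Subset using (⊤; ⊥; ⁅_⁆; _∪_; _∩_; _─_; _⊂_; Nonempty)
  renaming (_∈_ to _∈ₛ_)
open import Data.Fin.Subset.Properties
  using (anySubset?; _∈?_; _⊆?_; _⊂?_; ∣p∣≡n⇒p≡⊤; ⊆⊤; ∉⊥; x∈⁅x⁆; x∈p∩q⁺; p⊆p∪q)
open import Data.List using ([]; _∷_; map; filter; allFin)
open import Data.List.Membership.Propositional using (find; lose) renaming (_─_ to _─ₗ_)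
open import Data.List.Membership.Propositional.Properties
  using (∈-map⁺; ∈-map⁻; ∈-filter⁺; ∈-filter⁻; ∈-allFin)
open import Data.List.Properties using (length-map; length-removeAt′)
import Data.List.Relation.Unary.All as All
open import Data.List.Relation.Unary.AllPairs using ([]; _∷_; allPairs?)
open import Data.List.Relation.Unary.Any as Any using (here; there)
open import Data.List.Relation.Unary.Any.Properties using (any⁺; any⁻)
open import Data.Nat using (_≤_; z≤n; s≤s)
open import Data.Nat.Combinatorics using (_C_)
open import Data.Nat.Properties using (≤-trans; ≤-reflexive; 1+n≰n) renaming (_≟_ to _≟ℕ_)
open import Data.Product using (∃; _,_; proj₁; proj₂)
import Data.Product as Product
open import Data.Sum using (inj₁; inj₂; [_,_]′)
open import Data.Vec using (lookup; tabulate) renaming (_∷_ to _∷ᵥ_; [] to []ᵥ)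
open import Data.Vec.Properties
  using (≡-dec; ∷-injective; lookup∘tabulate; lookup-replicate; lookup⇒[]=; []=⇒lookup)
open import Function using (_∘_; id; case_of_)
open import Function.Bundles using (mk⇔; Equivalence)
open import Relation.Binary.Definitions using (DecidableEquality)
open import Relation.Binary.PropositionalEquality
  using (_≢_; refl; sym; trans; cong; cong₂; subst; subst₂; module ≡-Reasoning)
open import Relation.Nullary using (Dec; yes; no; ¬_; contradiction)
open import Relation.Nullary.Decidable
  using (from-yes; toWitness; fromWitness; decidable-stable; ¬?; _×-dec_; _⊎-dec_; _→-dec_; map′)
open import Relation.Unary using (Pred; Decidable)

open import Algebra.Properties.CommutativeMonoid.Sum
  (CommutativeRing.+-commutativeMonoid xor-∧-commutativeRing)
  using (sum-syntax; ∑-comm; sum-cong-≗)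

module _ {a} {A : Set a} where

  ∈-─⁺ : ∀ {x z : A} {ys} (x∈ys : x ∈ ys) → z ∈ ys → z ≢ x → z ∈ ys ─ₗ x∈ys
  ∈-─⁺ (here refl)  (here refl)  z≢x = contradiction refl z≢x
  ∈-─⁺ (here refl)  (there z∈ys) _   = z∈ys
  ∈-─⁺ (there _)    (here refl)  _   = here refl
  ∈-─⁺ (there x∈ys) (there z∈ys) z≢x = there (∈-─⁺ x∈ys z∈ys z≢x)

  unique-⊆⇒length≤ : ∀ {xs ys : List A} → Unique xs → (∀ {z} → z ∈ xs → z ∈ ys) →
                     length xs ≤ length ys
  unique-⊆⇒length≤ [] _ = z≤n
  unique-⊆⇒length≤ {ys = ys} (x≢xs ∷ xs-unique) xs⊆ys =
    ≤-trans (s≤s (unique-⊆⇒length≤ xs-unique xs⊆ys─x))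
            (≤-reflexive (sym (length-removeAt′ ys (Any.index x∈ys))))
    where
    x∈ys = xs⊆ys (here refl)
    xs⊆ys─x : ∀ {z} → z ∈ _ → z ∈ ys ─ₗ x∈ys
    xs⊆ys─x z∈xs = ∈-─⁺ x∈ys (xs⊆ys (there z∈xs)) λ z≡x → All.lookup x≢xs z∈xs (sym z≡x)

  unique-⊆∧length≥⇒⊇ : DecidableEquality A → ∀ {xs ys : List A} → Unique xs →
                       (∀ {z} → z ∈ xs → z ∈ ys) → length ys ≤ length xs →
                       ∀ {y} → y ∈ ys → y ∈ xs
  unique-⊆∧length≥⇒⊇ _≟ᴬ_ {xs} {ys} xs-unique xs⊆ys ys≤xs {y} y∈ys
    with Any.any? (y ≟ᴬ_) xs
  ... | yes y∈xs = y∈xs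
  ... | no  y∉xs = contradiction
    (subst (_≤ length (ys ─ₗ y∈ys)) (length-removeAt′ ys (Any.index y∈ys))
           (≤-trans ys≤xs (unique-⊆⇒length≤ xs-unique xs⊆ys─y)))
    1+n≰n
    where
    xs⊆ys─y : ∀ {z} → z ∈ xs → z ∈ ys ─ₗ y∈ys
    xs⊆ys─y z∈xs = ∈-─⁺ y∈ys (xs⊆ys z∈xs) λ { refl → y∉xs z∈xs }

  unique-map⇒injective : ∀ {b} {B : Set b} (f : A → B) {xs} → Unique (map f xs) →
                         ∀ {x y} → x ∈ xs → y ∈ xs → f x ≡ f y → x ≡ y
  unique-map⇒injective f (_ ∷ _)      (here refl) (here refl) _     = refl
  unique-map⇒injective f (fx≢ ∷ _)    (here refl) (there y∈)  fx≡fy =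
    contradiction fx≡fy (All.lookup fx≢ (∈-map⁺ f y∈))
  unique-map⇒injective f (fy≢ ∷ _)    (there x∈)  (here refl) fx≡fy =
    contradiction (sym fx≡fy) (All.lookup fy≢ (∈-map⁺ f x∈))
  unique-map⇒injective f (_ ∷ unique) (there x∈)  (there y∈)  fx≡fy =
    unique-map⇒injective f unique x∈ y∈ fx≡fy

infix 4 _≟ₛ_
_≟ₛ_ : ∀ {n} → DecidableEquality (Subset n)
_≟ₛ_ = ≡-dec _≟ᵇ_

allSubset? : ∀ {n ℓ} {Q : Pred (Subset n) ℓ} → Decidable Q → Dec (∀ p → Q p)
allSubset? Q? with anySubset? (¬? ∘ Q?)
... | yes (p , ¬Qp) = no λ ∀Q → ¬Qp (∀Q p)
... | no  ∄¬Q       = yes λ p → decidable-stable (Q? p) λ ¬Qp → ∄¬Q (p , ¬Qp)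

∪≡∧∩≡⊥⇒≡─ : ∀ {n} (X₁ Y₁ : Subset n) {M} → X₁ ∪ Y₁ ≡ M → X₁ ∩ Y₁ ≡ ⊥ → Y₁ ≡ M ─ X₁
∪≡∧∩≡⊥⇒≡─ []ᵥ []ᵥ refl refl = refl
∪≡∧∩≡⊥⇒≡─ (x ∷ᵥ X₁) (y ∷ᵥ Y₁) refl ∩≡⊥ with ∷-injective ∩≡⊥
∪≡∧∩≡⊥⇒≡─ (false ∷ᵥ X₁) (y ∷ᵥ Y₁)    refl _ | _ , ∩≡⊥ = cong (y ∷ᵥ_) (∪≡∧∩≡⊥⇒≡─ X₁ Y₁ refl ∩≡⊥)
∪≡∧∩≡⊥⇒≡─ (true ∷ᵥ X₁)  (false ∷ᵥ Y₁) refl _ | _ , ∩≡⊥ = cong (false ∷ᵥ_) (∪≡∧∩≡⊥⇒≡─ X₁ Y₁ refl ∩≡⊥)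
∪≡∧∩≡⊥⇒≡─ (true ∷ᵥ X₁)  (true ∷ᵥ Y₁)  refl _ | () , _

module _ {m k : ℕ} (f : Fin m → Fin k) where

  ∈-image⁺ : ∀ {A x} → x ∈ₛ A → f x ∈ₛ image f A
  ∈-image⁺ {A} {x} x∈A = lookup⇒[]= (f x) (image f A)
    (trans (lookup∘tabulate _ (f x)) (Equivalence.to T-≡ (any⁺ _ (lose (∈-allFin x) T[x∈A∧fx≡fx]))))
    where
    T[x∈A∧fx≡fx] = Equivalence.from T-∧ (Equivalence.from T-≡ ([]=⇒lookup x∈A) , fromWitness refl)

  ∈-image⁻ : ∀ {A y} → y ∈ₛ image f A → ∃ λ x → x ∈ₛ A × f x ≡ y
  ∈-image⁻ {A} {y} y∈
    with x , _ , T[x∈A∧fx≡y] ← find (any⁻ _ (allFin m)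
           (Equivalence.from T-≡ (trans (sym (lookup∘tabulate _ y)) ([]=⇒lookup y∈))))
    with T[x∈A] , T[fx≡y] ← Equivalence.to T-∧ T[x∈A∧fx≡y]
    = x , lookup⇒[]= x A (Equivalence.to T-≡ T[x∈A]) , toWitness T[fx≡y]

module _ {m : ℕ} where

  ≈δ-sym : ∀ {a b : Subset m × Subset m} → a ≈δ b → b ≈δ a
  ≈δ-sym (inj₁ (refl , refl)) = inj₁ (refl , refl)
  ≈δ-sym (inj₂ (refl , refl)) = inj₂ (refl , refl)

  ≈δ-trans : ∀ {a b c : Subset m × Subset m} → a ≈δ b → b ≈δ c → a ≈δ c
  ≈δ-trans (inj₁ (refl , refl)) b≈c                  = b≈c
  ≈δ-trans (inj₂ (refl , refl)) (inj₁ (refl , refl)) = inj₂ (refl , refl)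
  ≈δ-trans (inj₂ (refl , refl)) (inj₂ (refl , refl)) = inj₁ (refl , refl)

  ≈δ-map : ∀ {k} (f : Subset m → Subset k) {X Y X′ Y′} →
           (X , Y) ≈δ (X′ , Y′) → (f X , f Y) ≈δ (f X′ , f Y′)
  ≈δ-map f (inj₁ (refl , refl)) = inj₁ (refl , refl)
  ≈δ-map f (inj₂ (refl , refl)) = inj₂ (refl , refl)

  infix 4 _≈δ?_ _∈Θ?_
  _≈δ?_ : ∀ (a b : Subset m × Subset m) → Dec (a ≈δ b)
  (X₁ , Y₁) ≈δ? (X₂ , Y₂) = ((X₁ ≟ₛ X₂) ×-dec (Y₁ ≟ₛ Y₂)) ⊎-dec ((X₁ ≟ₛ Y₂) ×-dec (Y₁ ≟ₛ X₂))

  _∈Θ?_ : ∀ (D : Entry m) Θ′ → Dec (D ∈Θ Θ′)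
  D ∈Θ? Θ′ = map′ find (λ (_ , E∈ , E≈D) → lose E∈ E≈D)
    (Any.any? (λ E → (d E ≟ₛ d D) ×-dec ((X E , Y E) ≈δ? (X D , Y D))) Θ′)

  ∈Θ-resp : ∀ {D D′ : Entry m} {Θ′} → d D ≡ d D′ → (X D , Y D) ≈δ (X D′ , Y D′) →
            D ∈Θ Θ′ → D′ ∈Θ Θ′
  ∈Θ-resp d≡ δ≈ (E , E∈ , dE≡ , δE≈) = E , E∈ , trans dE≡ d≡ , ≈δ-trans δE≈ δ≈

  partitionEntry : Subset m → Subset m → Entry m
  partitionEntry d₀ X₀ = ⟨ d₀ ∣ X₀ , ⊤ ─ d₀ ─ X₀ ⟩

  wellFormed⇒partition : ∀ {D : Entry m} → WellFormedEntry ⊤ D →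
                         D ≡ partitionEntry (d D) (X D) × X D ⊆ ⊤ ─ d D
  wellFormed⇒partition {⟨ d₀ ∣ X₀ , Y₀ ⟩} (_ , _ , _ , ∪≡ , ∩≡⊥) =
    cong ⟨ d₀ ∣ X₀ ,_⟩ (∪≡∧∩≡⊥⇒≡─ X₀ Y₀ ∪≡ ∩≡⊥) , subst (X₀ ⊆_) ∪≡ (p⊆p∪q Y₀)

  Split : Entry m → Set
  Split D = Nonempty (X D) × Nonempty (Y D)

  ≈δ-singletons⇒Split : ∀ {D u v} → (X D , Y D) ≈δ (⁅ u ⁆ , ⁅ v ⁆) → Split D
  ≈δ-singletons⇒Split {u = u} {v} (inj₁ (refl , refl)) = (u , x∈⁅x⁆ u) , (v , x∈⁅x⁆ v)
  ≈δ-singletons⇒Split {u = u} {v} (inj₂ (refl , refl)) = (v , x∈⁅x⁆ v) , (u , x∈⁅x⁆ u)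

module _ {m k : ℕ} (f : Fin m → Fin k) where

  imageEntry : Entry m → Entry k
  imageEntry D = ⟨ image f (d D) ∣ image f (X D) , image f (Y D) ⟩

  Split-image : ∀ {D} → Split D → Split (imageEntry D)
  Split-image ((x , x∈) , (y , y∈)) = (f x , ∈-image⁺ f x∈) , (f y , ∈-image⁺ f y∈)

Conc₄¹-Split⇒0∈d : ∀ {D} → D ∈Θ Θ Conc₄¹ → Split D → # 0 ∈ₛ d D
Conc₄¹-Split⇒0∈d {D} (_ , D′∈ , d≡ , δ≈) split = subst (# 0 ∈ₛ_) d≡ (apex D′∈ δ≈)
  where
  ⊥-block⇒¬Split : ∀ {X′} → (X′ , ⊥) ≈δ (X D , Y D) → ¬ Split D
  ⊥-block⇒¬Split (inj₁ (_ , ⊥≡Y)) (_ , y , y∈Y)   = ∉⊥ (subst (y ∈ₛ_) (sym ⊥≡Y) y∈Y)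
  ⊥-block⇒¬Split (inj₂ (_ , ⊥≡X)) ((x , x∈X) , _) = ∉⊥ (subst (x ∈ₛ_) (sym ⊥≡X) x∈X)

  apex : ∀ {E} → E ∈ Θ Conc₄¹ → (X E , Y E) ≈δ (X D , Y D) → # 0 ∈ₛ d E
  apex (here refl)                                 _  = lookup⇒[]= (# 0) _ refl
  apex (there (here refl))                         _  = lookup⇒[]= (# 0) _ refl
  apex (there (there (here refl)))                 _  = lookup⇒[]= (# 0) _ refl
  apex (there (there (there (here refl))))         δ≈ = contradiction split (⊥-block⇒¬Split δ≈)
  apex (there (there (there (there (here refl))))) δ≈ = contradiction split (⊥-block⇒¬Split δ≈)
  apex (there (there (there (there (there (here refl)))))) δ≈ =
    contradiction split (⊥-block⇒¬Split δ≈)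

≅Conc₄¹⇒Split-entries-meet : ∀ {m} {𝒜 : RawDPS m} → Isomorphic 𝒜 Conc₄¹ →
  ∀ {D₁ D₂} → D₁ ∈ Θ 𝒜 → D₂ ∈ Θ 𝒜 → d D₁ ⊆ P 𝒜 → d D₂ ⊆ P 𝒜 → Split D₁ → Split D₂ →
  Nonempty (d D₁ ∩ d D₂)
≅Conc₄¹⇒Split-entries-meet {𝒜 = 𝒜} (f , (f-injective , _) , images) {D₁} {D₂}
  D₁∈ D₂∈ d₁⊆P d₂⊆P split₁ split₂ =
  meet (∈-image⁻ f (apex D₁∈ split₁)) (∈-image⁻ f (apex D₂∈ split₂))
  where
  apex : ∀ {D} → D ∈ Θ 𝒜 → Split D → # 0 ∈ₛ image f (d D)
  apex {D} D∈ split = Conc₄¹-Split⇒0∈d (All.lookup images D∈) (Split-image f {D} split)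

  meet : (∃ λ x → x ∈ₛ d D₁ × f x ≡ # 0) → (∃ λ x → x ∈ₛ d D₂ × f x ≡ # 0) →
         Nonempty (d D₁ ∩ d D₂)
  meet (x₁ , x₁∈d₁ , fx₁≡0) (x₂ , x₂∈d₂ , fx₂≡0)
    with refl ← f-injective (d₁⊆P x₁∈d₁) (d₂⊆P x₂∈d₂) (trans fx₁≡0 (sym fx₂≡0))
    = x₁ , x∈p∩q⁺ (x₁∈d₁ , x₂∈d₂)

≡false⇔≡⇒xor≡false : ∀ a b c → (a ≡ false ⇔ b ≡ c) → a xor b xor c ≡ false
≡false⇔≡⇒xor≡false false b     c     a⇔ =
  trans (cong (_xor c) (Equivalence.to a⇔ refl)) (xor-same c)
≡false⇔≡⇒xor≡false true  false true  _  = refl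
≡false⇔≡⇒xor≡false true  true  false _  = refl
≡false⇔≡⇒xor≡false true  false false a⇔ = contradiction (Equivalence.from a⇔ refl) λ ()
≡false⇔≡⇒xor≡false true  true  true  a⇔ = contradiction (Equivalence.from a⇔ refl) λ ()

-- Edge labellings of K₄

-- In this order of the edges, opposite k is the edge disjoint from k.
K4-ends : Fin 6 → Fin 4 × Fin 4
K4-ends = lookup
  ((# 0 , # 1) ∷ᵥ (# 0 , # 2) ∷ᵥ (# 0 , # 3) ∷ᵥ (# 1 , # 2) ∷ᵥ (# 1 , # 3) ∷ᵥ (# 2 , # 3) ∷ᵥ []ᵥ)

star : Fin 4 → Fin 3 → Fin 6
star v = lookup (lookup
  (  (# 0 ∷ᵥ # 1 ∷ᵥ # 2 ∷ᵥ []ᵥ) ∷ᵥ (# 0 ∷ᵥ # 3 ∷ᵥ # 4 ∷ᵥ []ᵥ)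
  ∷ᵥ (# 1 ∷ᵥ # 3 ∷ᵥ # 5 ∷ᵥ []ᵥ) ∷ᵥ (# 2 ∷ᵥ # 4 ∷ᵥ # 5 ∷ᵥ []ᵥ) ∷ᵥ []ᵥ) v)

IsEven : Subset 6 → Set
IsEven ℓ = ∀ v →
  lookup ℓ (star v (# 0)) xor lookup ℓ (star v (# 1)) xor lookup ℓ (star v (# 2)) ≡ false

isEven? : Decidable IsEven
isEven? ℓ = all? λ v →
  lookup ℓ (star v (# 0)) xor lookup ℓ (star v (# 1)) xor lookup ℓ (star v (# 2)) ≟ᵇ false

data Cycle : Set where
  triangle : Fin 4 → Cycle
  square   : Fin 3 → Cycle

edges : Cycle → Subset 6
edges (triangle v) = ⊤ ─ ⁅ star v (# 0) ⁆ ─ ⁅ star v (# 1) ⁆ ─ ⁅ star v (# 2) ⁆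
edges (square j)   = ⊤ ─ ⁅ star (# 0) j ⁆ ─ ⁅ opposite (star (# 0) j) ⁆

isTriangle : Cycle → Bool
isTriangle (triangle _) = true
isTriangle (square _)   = false

allCycle? : ∀ {ℓ} {Q : Pred Cycle ℓ} → Decidable Q → Dec (∀ γ → Q γ)
allCycle? Q? = map′ (λ (Q▵ , Q□) → λ { (triangle v) → Q▵ v ; (square j) → Q□ j })
                    (λ ∀Q → ∀Q ∘ triangle , ∀Q ∘ square)
                    (all? (Q? ∘ triangle) ×-dec all? (Q? ∘ square))

model : Cycle → RawDPS 4
model (triangle _) = Conc₄¹
model (square _)   = Conv₄

normalise : Cycle → Fin 4 → Fin 4
normalise (triangle v) = transpose v (# 0)
normalise (square j)   = transpose (suc j) (# 2)

-- The facts proved by exhaustive evaluation of a decision procedure are opaque, so that later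
-- conversion checks never unfold that evaluation.
opaque
  even⇒cycle : ∀ ℓ → IsEven ℓ → ℓ ≢ ⊥ → ∃ λ γ → ℓ ≡ edges γ
  even⇒cycle ℓ ℓ-even ℓ≢⊥ =
    [ Product.map triangle id , Product.map square id ]′ (classify ℓ ℓ-even ℓ≢⊥)
    where
    classify : ∀ ℓ → IsEven ℓ → ℓ ≢ ⊥ →
               (∃ λ v → ℓ ≡ edges (triangle v)) ⊎ (∃ λ j → ℓ ≡ edges (square j))
    classify = from-yes (allSubset? λ ℓ → isEven? ℓ →-dec ¬? (ℓ ≟ₛ ⊥) →-dec
      (any? (λ v → ℓ ≟ₛ edges (triangle v)) ⊎-dec any? (λ j → ℓ ≟ₛ edges (square j))))

  ∑-edges≡isTriangle : ∀ γ → ∑[ k < 6 ] lookup (edges γ) k ≡ isTriangle γ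
  ∑-edges≡isTriangle = from-yes (allCycle? λ γ → ∑[ k < 6 ] lookup (edges γ) k ≟ᵇ isTriangle γ)

  square-avoids-matching : ∀ j → lookup (edges (square j)) (star (# 0) j) ≡ false
                               × lookup (edges (square j)) (opposite (star (# 0) j)) ≡ false
  square-avoids-matching = from-yes (all? λ j →
    (lookup (edges (square j)) (star (# 0) j) ≟ᵇ false)
    ×-dec (lookup (edges (square j)) (opposite (star (# 0) j)) ≟ᵇ false))

-- The five-point universe

pair : Fin 10 → Subset 5
pair = lookup
  (  ⟦ # 0 ∷ # 1 ∷ [] ⟧ ∷ᵥ ⟦ # 0 ∷ # 2 ∷ [] ⟧ ∷ᵥ ⟦ # 0 ∷ # 3 ∷ [] ⟧ ∷ᵥ ⟦ # 0 ∷ # 4 ∷ [] ⟧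
  ∷ᵥ ⟦ # 1 ∷ # 2 ∷ [] ⟧ ∷ᵥ ⟦ # 1 ∷ # 3 ∷ [] ⟧ ∷ᵥ ⟦ # 1 ∷ # 4 ∷ [] ⟧
  ∷ᵥ ⟦ # 2 ∷ # 3 ∷ [] ⟧ ∷ᵥ ⟦ # 2 ∷ # 4 ∷ [] ⟧
  ∷ᵥ ⟦ # 3 ∷ # 4 ∷ [] ⟧ ∷ᵥ []ᵥ)

-- The index of the pair {a , b}; the diagonal entries are arbitrary.
pairIndex : Fin 5 → Fin 5 → Fin 10
pairIndex a b = lookup (lookup
  (  (# 0 ∷ᵥ # 0 ∷ᵥ # 1 ∷ᵥ # 2 ∷ᵥ # 3 ∷ᵥ []ᵥ)
  ∷ᵥ (# 0 ∷ᵥ # 0 ∷ᵥ # 4 ∷ᵥ # 5 ∷ᵥ # 6 ∷ᵥ []ᵥ)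
  ∷ᵥ (# 1 ∷ᵥ # 4 ∷ᵥ # 0 ∷ᵥ # 7 ∷ᵥ # 8 ∷ᵥ []ᵥ)
  ∷ᵥ (# 2 ∷ᵥ # 5 ∷ᵥ # 7 ∷ᵥ # 0 ∷ᵥ # 9 ∷ᵥ []ᵥ)
  ∷ᵥ (# 3 ∷ᵥ # 6 ∷ᵥ # 8 ∷ᵥ # 9 ∷ᵥ # 0 ∷ᵥ []ᵥ) ∷ᵥ []ᵥ) a) b

without : Fin 5 → Subset 5
without c = ⊤ ─ ⁅ c ⁆

localEnds : Fin 5 → Fin 6 → Fin 5 × Fin 5
localEnds c k = Product.map (punchIn c) (punchIn c) (K4-ends k)

localPair : Fin 5 → Fin 6 → Fin 10
localPair c k = Product.uncurry pairIndex (localEnds c k)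

starPair : Fin 5 → Fin 4 → Fin 3 → Subset 5
starPair c v i = pair (localPair c (star v i))

localBlocks : Fin 5 → Fin 6 → Bool → Subset 5 × Subset 5
localBlocks c k true  = without c ─ pair (localPair c k) , ⊥
localBlocks c k false = ⁅ proj₁ (localEnds c (opposite k)) ⁆ , ⁅ proj₂ (localEnds c (opposite k)) ⁆

localEntry : Fin 5 → Fin 6 → Bool → Entry 5
localEntry c k b = ⟨ pair (localPair c k) ∣ proj₁ (localBlocks c k b) , proj₂ (localBlocks c k b) ⟩

-- The value at c itself is irrelevant: c lies outside without c.
relabel : Fin 5 → Cycle → Fin 5 → Fin 4
relabel c γ x with c ≟ x
... | yes _  = # 0
... | no c≢x = normalise γ (punchOut c≢x)

omissionLabel : Fin 10 → Entry 5 → Fin 5 → Bool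
omissionLabel p D c = if lookup (pair p) c then false else φ[ D , without c ]

omissions : Subset 5 → List (Subset 5)
omissions s = map without (filter (λ c → lookup s c ≟ᵇ true) (allFin 5))

opaque
  pairOf : ∀ s → ∣ s ∣ ≡ 2 → ∃ λ p → s ≡ pair p
  pairOf = from-yes (allSubset? λ s → (∣ s ∣ ≟ℕ 2) →-dec any? λ p → s ≟ₛ pair p)

  ∣without∣≡4 : ∀ c → ∣ without c ∣ ≡ 4
  ∣without∣≡4 = from-yes (all? λ c → ∣ without c ∣ ≟ℕ 4)

  ∣R∣≡4⇒≡without : ∀ R → ∣ R ∣ ≡ 4 → ∃ λ c → R ≡ without c
  ∣R∣≡4⇒≡without = from-yes (allSubset? λ R → (∣ R ∣ ≟ℕ 4) →-dec any? λ c → R ≟ₛ without c)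

  localPair⊆without : ∀ c k → pair (localPair c k) ⊆ without c
  localPair⊆without = from-yes (all? λ c → all? λ k → pair (localPair c k) ⊆? without c)

  localPair-surjective : ∀ c p → pair p ⊆ without c → ∃ λ k → localPair c k ≡ p
  localPair-surjective = from-yes (all? λ c → all? λ p →
    (pair p ⊆? without c) →-dec any? λ k → localPair c k ≟ p)

  opposite-disjoint : ∀ c k → pair (localPair c k) ∩ pair (localPair c (opposite k)) ≡ ⊥
  opposite-disjoint = from-yes (all? λ c → all? λ k →
    pair (localPair c k) ∩ pair (localPair c (opposite k)) ≟ₛ ⊥)

  star-covers : ∀ c v →
    starPair c v (# 0) ∪ starPair c v (# 1) ∪ starPair c v (# 2) ≡ without c
    × ∣ starPair c v (# 0) ∩ starPair c v (# 1) ∩ starPair c v (# 2) ∣ ≡ 1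
  star-covers = from-yes (all? λ c → all? λ v →
    (starPair c v (# 0) ∪ starPair c v (# 1) ∪ starPair c v (# 2) ≟ₛ without c)
    ×-dec (∣ starPair c v (# 0) ∩ starPair c v (# 1) ∩ starPair c v (# 2) ∣ ≟ℕ 1))

  -- The local edges 0, 1 and 3 form the triangle on the local vertices 0, 1 and 2.
  triangle-spans : ∀ c → let p = pair ∘ localPair c in
    p (# 0) ≢ p (# 1) × p (# 0) ≢ p (# 3) × p (# 1) ≢ p (# 3)
    × p (# 0) ∪ p (# 1) ∪ p (# 3) ⊂ without c × ∣ p (# 0) ∪ p (# 1) ∪ p (# 3) ∣ ≡ 3
  triangle-spans = from-yes (all? λ c → let p = pair ∘ localPair c in
    ¬? (p (# 0) ≟ₛ p (# 1)) ×-dec ¬? (p (# 0) ≟ₛ p (# 3)) ×-dec ¬? (p (# 1) ≟ₛ p (# 3))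
    ×-dec (p (# 0) ∪ p (# 1) ∪ p (# 3) ⊂? without c) ×-dec (∣ p (# 0) ∪ p (# 1) ∪ p (# 3) ∣ ≟ℕ 3))

  restrict-partition≈localBlocks : ∀ c k X₀ → X₀ ⊆ ⊤ ─ pair (localPair c k) →
    let D = partitionEntry (pair (localPair c k)) X₀ in
    (X D ∩ without c , Y D ∩ without c) ≈δ localBlocks c k φ[ D , without c ]
  restrict-partition≈localBlocks = from-yes (all? λ c → all? λ k → allSubset? λ X₀ →
    let D = partitionEntry (pair (localPair c k)) X₀ in
    (X₀ ⊆? ⊤ ─ pair (localPair c k)) →-dec
    ((X D ∩ without c , Y D ∩ without c) ≈δ? localBlocks c k φ[ D , without c ]))

  localEntry-image∈model : ∀ c γ k →
    imageEntry (relabel c γ) (localEntry c k (lookup (edges γ) k)) ∈Θ Θ (model γ)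
  localEntry-image∈model = from-yes (all? λ c → allCycle? λ γ → all? λ k →
    imageEntry (relabel c γ) (localEntry c k (lookup (edges γ) k)) ∈Θ? Θ (model γ))

  relabel-injective : ∀ c γ x y → x ∈ₛ without c → y ∈ₛ without c →
                      relabel c γ x ≡ relabel c γ y → x ≡ y
  relabel-injective = from-yes (all? λ c → allCycle? λ γ → all? λ x → all? λ y →
    (x ∈? without c) →-dec (y ∈? without c) →-dec (relabel c γ x ≟ relabel c γ y) →-dec (x ≟ y))

  relabel-onto : ∀ c γ → image (relabel c γ) (without c) ≡ P (model γ)
  relabel-onto = from-yes (all? λ c → allCycle? λ γ →
    image (relabel c γ) (without c) ≟ₛ P (model γ))

  -- Of the three points outside pair p, either all lie in one block (then every omission
  -- gives φ = true) or exactly two do (then exactly one omission does).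
  omissionLabels-odd : ∀ p X₀ → X₀ ⊆ ⊤ ─ pair p →
    ∑[ c < 5 ] omissionLabel p (partitionEntry (pair p) X₀) c ≡ true
  omissionLabels-odd = from-yes (all? λ p → allSubset? λ X₀ → (X₀ ⊆? ⊤ ─ pair p) →-dec
    (∑[ c < 5 ] omissionLabel p (partitionEntry (pair p) X₀) c ≟ᵇ true))

  omissions-unique : ∀ s → Unique (omissions s)
  omissions-unique = from-yes (allSubset? λ s → allPairs? (λ R R′ → ¬? (R ≟ₛ R′)) (omissions s))

  without∈omissions⇔ : ∀ s c → (without c ∈ omissions s → lookup s c ≡ true)
                             × (lookup s c ≡ true → without c ∈ omissions s)
  without∈omissions⇔ = from-yes (allSubset? λ s → all? λ c →
    (Any.any? (without c ≟ₛ_) (omissions s) →-dec lookup s c ≟ᵇ true)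
    ×-dec (lookup s c ≟ᵇ true →-dec Any.any? (without c ≟ₛ_) (omissions s)))

  omissions-length : ∀ s → ∑[ c < 5 ] lookup s c ≡ false →
    length (omissions s) ≡ 4 ⊎ length (omissions s) ≡ 2 ⊎ length (omissions s) ≡ 0
  omissions-length = from-yes (allSubset? λ s → (∑[ c < 5 ] lookup s c ≟ᵇ false) →-dec
    ((length (omissions s) ≟ℕ 4) ⊎-dec (length (omissions s) ≟ℕ 2)
      ⊎-dec (length (omissions s) ≟ℕ 0)))

∈omissions⇒∣∣≡4 : ∀ s {R} → R ∈ omissions s → ∣ R ∣ ≡ 4
∈omissions⇒∣∣≡4 _ R∈ with c , _ , refl ← ∈-map⁻ without R∈ = ∣without∣≡4 c

-- A five-point div point set

module FivePointDivSet (𝒳 : RawDPS 5) (isDPS : IsDivPointSet 𝒳) (∣P∣≡5 : ∣ P 𝒳 ∣ ≡ 5)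
                       (l1 : L1 𝒳) (l3 : L3 𝒳) where
  open IsDivPointSet isDPS

  P≡⊤ : P 𝒳 ≡ ⊤
  P≡⊤ = ∣p∣≡n⇒p≡⊤ ∣P∣≡5

  ⊆P : ∀ R → R ⊆ P 𝒳
  ⊆P R = subst (R ⊆_) (sym P≡⊤) ⊆⊤

  wellFormed : ∀ {D} → D ∈ Θ 𝒳 → WellFormedEntry ⊤ D
  wellFormed {D} D∈ = subst (λ P₀ → WellFormedEntry P₀ D) P≡⊤ (All.lookup entries D∈)

  pair∈ds : ∀ p → pair p ∈ map d (Θ 𝒳)
  pair∈ds p = unique-⊆∧length≥⇒⊇ _≟ₛ_ uniqueD d∈pairs (≤-reflexive (sym length≡10))
                                  (∈-map⁺ pair (∈-allFin p))
    where
    d∈pairs : ∀ {s} → s ∈ map d (Θ 𝒳) → s ∈ map pair (allFin 10)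
    d∈pairs s∈ with D , D∈ , refl ← ∈-map⁻ d s∈
                with p , dD≡ ← pairOf (d D) (proj₁ (proj₂ (wellFormed D∈)))
      = subst (_∈ _) (sym dD≡) (∈-map⁺ pair (∈-allFin p))

    length≡10 : length (map d (Θ 𝒳)) ≡ 10
    length≡10 = trans (length-map d (Θ 𝒳)) (trans cardinality (cong (_C 2) ∣P∣≡5))

  opaque
    θ : Fin 10 → Entry 5
    θ p = proj₁ (∈-map⁻ d (pair∈ds p))

    θ∈Θ : ∀ p → θ p ∈ Θ 𝒳
    θ∈Θ p = proj₁ (proj₂ (∈-map⁻ d (pair∈ds p)))

    d-θ : ∀ p → d (θ p) ≡ pair p
    d-θ p = sym (proj₂ (proj₂ (∈-map⁻ d (pair∈ds p))))

  θ-unique : ∀ {D} p → D ∈ Θ 𝒳 → d D ≡ pair p → D ≡ θ p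
  θ-unique p D∈ dD≡ = unique-map⇒injective d uniqueD D∈ (θ∈Θ p) (trans dD≡ (sym (d-θ p)))

  θ-distinct : ∀ p q → pair p ≢ pair q → θ p ≢ θ q
  θ-distinct p q p≢q θp≡θq = p≢q (trans (sym (d-θ p)) (trans (cong d θp≡θq) (d-θ q)))

  θ-partition : ∀ p → θ p ≡ partitionEntry (pair p) (X (θ p)) × X (θ p) ⊆ ⊤ ─ pair p
  θ-partition p = subst (λ d₀ → θ p ≡ partitionEntry d₀ (X (θ p)) × X (θ p) ⊆ ⊤ ─ d₀) (d-θ p)
                        (wellFormed⇒partition (wellFormed (θ∈Θ p)))

  θ-local : ∀ c {D} → D ∈ Θ 𝒳 → d D ⊆ without c → ∃ λ k → D ≡ θ (localPair c k)
  θ-local c {D} D∈ dD⊆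
    with p , dD≡ ← pairOf (d D) (proj₁ (proj₂ (wellFormed D∈)))
    with k , refl ← localPair-surjective c p (subst (_⊆ without c) dD≡ dD⊆)
    = k , θ-unique (localPair c k) D∈ dD≡

  label : Fin 5 → Fin 6 → Bool
  label c k = φ[ θ (localPair c k) , without c ]

  labelling : Fin 5 → Subset 6
  labelling c = tabulate (label c)

  lookup-labelling : ∀ c k → lookup (labelling c) k ≡ label c k
  lookup-labelling c k = lookup∘tabulate (label c) k

  labelling-even : ∀ c → IsEven (labelling c)
  labelling-even c v =
    trans (cong₂ _xor_ (lookup-labelling c k₀)
                       (cong₂ _xor_ (lookup-labelling c k₁) (lookup-labelling c k₂)))
      (≡false⇔≡⇒xor≡false (label c k₀) (label c k₁) (label c k₂)
        (l1 (without c) (⊆P (without c)) (∣without∣≡4 c) (θ∈Θ p₀) (θ∈Θ p₁) (θ∈Θ p₂)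
          (trans (cong₂ _∪_ (d-θ p₀) (cong₂ _∪_ (d-θ p₁) (d-θ p₂))) (proj₁ (star-covers c v)))
          (trans (cong ∣_∣ (cong₂ _∩_ (d-θ p₀) (cong₂ _∩_ (d-θ p₁) (d-θ p₂))))
                 (proj₂ (star-covers c v)))))
    where
    k₀ = star v (# 0)
    k₁ = star v (# 1)
    k₂ = star v (# 2)
    p₀ = localPair c k₀
    p₁ = localPair c k₁
    p₂ = localPair c k₂

  labelling≢⊥ : ∀ c → labelling c ≢ ⊥
  labelling≢⊥ c ℓ≡⊥
    with p₀≢p₁ , p₀≢p₂ , p₁≢p₂ , union⊂ , ∣union∣≡3 ← triangle-spans c
    = not-¬ (label≡false (# 3))
        (l3 (without c) (⊆P (without c)) (∣without∣≡4 c) (θ∈Θ p₀) (θ∈Θ p₁) (θ∈Θ p₂)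
            (θ-distinct p₀ p₁ p₀≢p₁) (θ-distinct p₀ p₂ p₀≢p₂) (θ-distinct p₁ p₂ p₁≢p₂)
            (subst (_⊂ without c) (sym d-union) union⊂) (trans (cong ∣_∣ d-union) ∣union∣≡3)
            (label≡false (# 0)) (label≡false (# 1)))
    where
    p₀ = localPair c (# 0)
    p₁ = localPair c (# 1)
    p₂ = localPair c (# 3)
    d-union : d (θ p₀) ∪ d (θ p₁) ∪ d (θ p₂) ≡ pair p₀ ∪ pair p₁ ∪ pair p₂
    d-union = cong₂ _∪_ (d-θ p₀) (cong₂ _∪_ (d-θ p₁) (d-θ p₂))
    label≡false : ∀ k → label c k ≡ false
    label≡false k = trans (sym (lookup-labelling c k))
                          (trans (cong (λ ℓ → lookup ℓ k) ℓ≡⊥) (lookup-replicate k false))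

  cycleOf : Fin 5 → Cycle
  cycleOf c = proj₁ (even⇒cycle (labelling c) (labelling-even c) (labelling≢⊥ c))

  labelling≡edges : ∀ c → labelling c ≡ edges (cycleOf c)
  labelling≡edges c = proj₂ (even⇒cycle (labelling c) (labelling-even c) (labelling≢⊥ c))

  restrictedθ : Fin 5 → Fin 6 → Entry 5
  restrictedθ c k = restrict (without c) (θ (localPair c k))

  restrictedθ∈sub : ∀ c k → restrictedθ c k ∈ Θ (sub 𝒳 (without c))
  restrictedθ∈sub c k = ∈-map⁺ (restrict (without c))
    (∈-filter⁺ (λ e → d e ⊆? without c) (θ∈Θ (localPair c k))
      (subst (_⊆ without c) (sym (d-θ (localPair c k))) (localPair⊆without c k)))

  sub-entry⇒restrictedθ : ∀ c {E} → E ∈ Θ (sub 𝒳 (without c)) → ∃ λ k → E ≡ restrictedθ c k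
  sub-entry⇒restrictedθ c E∈ with D , D∈filter , refl ← ∈-map⁻ (restrict (without c)) E∈ =
    Product.map id (cong (restrict (without c)))
      (Product.uncurry (θ-local c) (∈-filter⁻ (λ e → d e ⊆? without c) D∈filter))

  restrictedθ≈localBlocks : ∀ c k →
    (X (restrictedθ c k) , Y (restrictedθ c k)) ≈δ localBlocks c k (lookup (labelling c) k)
  restrictedθ≈localBlocks c k =
    subst₂ (λ D b → (X D ∩ without c , Y D ∩ without c) ≈δ localBlocks c k b)
      (sym θp≡) (trans (cong φ[_, without c ] (sym θp≡)) (sym (lookup-labelling c k)))
      (restrict-partition≈localBlocks c k (X (θ p)) X⊆)
    where
    p = localPair c k
    θp≡ = proj₁ (θ-partition p)
    X⊆ = proj₂ (θ-partition p)

  restrictedθ-image∈model : ∀ c k →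
    imageEntry (relabel c (cycleOf c)) (restrictedθ c k) ∈Θ Θ (model (cycleOf c))
  restrictedθ-image∈model c k =
    ∈Θ-resp {D = imageEntry f (localEntry c k (lookup (labelling c) k))}
            {D′ = imageEntry f (restrictedθ c k)}
            (cong (image f) (sym (d-θ (localPair c k))))
            (≈δ-map (image f) (≈δ-sym (restrictedθ≈localBlocks c k)))
            (subst (λ b → imageEntry f (localEntry c k b) ∈Θ Θ (model (cycleOf c)))
                   (cong (λ ℓ → lookup ℓ k) (sym (labelling≡edges c)))
                   (localEntry-image∈model c (cycleOf c) k))
    where
    f = relabel c (cycleOf c)

  sub≅model : ∀ c → Isomorphic (sub 𝒳 (without c)) (model (cycleOf c))
  sub≅model c =
    f , ((λ {x} {y} → relabel-injective c (cycleOf c) x y) , relabel-onto c (cycleOf c)) ,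
    All.tabulate λ E∈ → image∈model (sub-entry⇒restrictedθ c E∈)
    where
    f = relabel c (cycleOf c)
    image∈model : ∀ {E} → ∃ (λ k → E ≡ restrictedθ c k) → imageEntry f E ∈Θ Θ (model (cycleOf c))
    image∈model (k , refl) = restrictedθ-image∈model c k

  unlabelled⇒Split : ∀ c k → lookup (labelling c) k ≡ false → Split (restrictedθ c k)
  unlabelled⇒Split c k unlabelled = ≈δ-singletons⇒Split {D = restrictedθ c k}
    (subst (λ b → (X (restrictedθ c k) , Y (restrictedθ c k)) ≈δ localBlocks c k b)
           unlabelled (restrictedθ≈localBlocks c k))

  square≇Conc₄¹ : ∀ c j → cycleOf c ≡ square j → ¬ Isomorphic (sub 𝒳 (without c)) Conc₄¹
  square≇Conc₄¹ c j γ≡square iso =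
    case ≅Conc₄¹⇒Split-entries-meet iso (restrictedθ∈sub c k) (restrictedθ∈sub c k′)
           (d⊆without k) (d⊆without k′)
           (unlabelled⇒Split c k (unlabelled k (proj₁ (square-avoids-matching j))))
           (unlabelled⇒Split c k′ (unlabelled k′ (proj₂ (square-avoids-matching j))))
    of λ (x , x∈) →
      ∉⊥ (subst (x ∈ₛ_) (opposite-disjoint c k)
           (subst₂ (λ A B → x ∈ₛ A ∩ B) (d-θ (localPair c k)) (d-θ (localPair c k′)) x∈))
    where
    k = star (# 0) j
    k′ = opposite k
    d⊆without : ∀ k → d (restrictedθ c k) ⊆ without c
    d⊆without k = subst (_⊆ without c) (sym (d-θ (localPair c k))) (localPair⊆without c k)
    unlabelled : ∀ k → lookup (edges (square j)) k ≡ false → lookup (labelling c) k ≡ false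
    unlabelled k = trans (cong (λ ℓ → lookup ℓ k) (trans (labelling≡edges c) (cong edges γ≡square)))

  -- Both sides add the labels of the six pairs inside without c in the same order; the pairs
  -- through c contribute false.
  local≡global : ∀ c → ∑[ k < 6 ] lookup (labelling c) k ≡ ∑[ p < 10 ] omissionLabel p (θ p) c
  local≡global zero                         = refl
  local≡global (suc zero)                   = refl
  local≡global (suc (suc zero))             = refl
  local≡global (suc (suc (suc zero)))       = refl
  local≡global (suc (suc (suc (suc zero)))) = refl

  omissionLabels-θ-odd : ∀ p → ∑[ c < 5 ] omissionLabel p (θ p) c ≡ true
  omissionLabels-θ-odd p =
    subst (λ D → ∑[ c < 5 ] omissionLabel p D c ≡ true) (sym (proj₁ (θ-partition p)))
          (omissionLabels-odd p (X (θ p)) (proj₂ (θ-partition p)))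

  triangleOmissions : Subset 5
  triangleOmissions = tabulate (isTriangle ∘ cycleOf)

  lookup-triangleOmissions : ∀ c → lookup triangleOmissions c ≡ isTriangle (cycleOf c)
  lookup-triangleOmissions = lookup∘tabulate (isTriangle ∘ cycleOf)

  triangleOmissions-even : ∑[ c < 5 ] lookup triangleOmissions c ≡ false
  triangleOmissions-even = begin
    ∑[ c < 5 ] lookup triangleOmissions c           ≡⟨ sum-cong-≗ triangle≡∑labels ⟩
    ∑[ c < 5 ] ∑[ k < 6 ] lookup (labelling c) k    ≡⟨ sum-cong-≗ local≡global ⟩
    ∑[ c < 5 ] ∑[ p < 10 ] omissionLabel p (θ p) c  ≡⟨ ∑-comm (λ c p → omissionLabel p (θ p) c) ⟩
    ∑[ p < 10 ] ∑[ c < 5 ] omissionLabel p (θ p) c  ≡⟨ sum-cong-≗ omissionLabels-θ-odd ⟩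
    ∑[ p < 10 ] true                                ≡⟨⟩
    false                                           ∎
    where
    open ≡-Reasoning
    triangle≡∑labels : ∀ c → lookup triangleOmissions c ≡ ∑[ k < 6 ] lookup (labelling c) k
    triangle≡∑labels c = begin
      lookup triangleOmissions c               ≡⟨ lookup-triangleOmissions c ⟩
      isTriangle (cycleOf c)                   ≡⟨ ∑-edges≡isTriangle (cycleOf c) ⟨
      ∑[ k < 6 ] lookup (edges (cycleOf c)) k  ≡⟨ cong (λ ℓ → ∑[ k < 6 ] lookup ℓ k) ℓ≡edges ⟨
      ∑[ k < 6 ] lookup (labelling c) k        ∎
      where ℓ≡edges = labelling≡edges c

  Classified : Subset 5 → Set
  Classified R = (R ∈ omissions triangleOmissions ⇔ Isomorphic (sub 𝒳 R) Conc₄¹)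
               × (R ∉ omissions triangleOmissions → Isomorphic (sub 𝒳 R) Conv₄)

  without-classified : ∀ c → Classified (without c)
  without-classified c = by-cycle (cycleOf c) refl
    where
    T = triangleOmissions
    𝒴 = sub 𝒳 (without c)

    ∈⇔triangle : without c ∈ omissions T ⇔ isTriangle (cycleOf c) ≡ true
    ∈⇔triangle = mk⇔
      (λ ∈T → trans (sym (lookup-triangleOmissions c)) (proj₁ (without∈omissions⇔ T c) ∈T))
      (λ triangle → proj₂ (without∈omissions⇔ T c) (trans (lookup-triangleOmissions c) triangle))

    𝒴≅model : ∀ {γ} → cycleOf c ≡ γ → Isomorphic 𝒴 (model γ)
    𝒴≅model γ≡ = subst (Isomorphic 𝒴 ∘ model) γ≡ (sub≅model c)

    by-cycle : ∀ γ → cycleOf c ≡ γ → Classified (without c)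
    by-cycle (triangle _) γ≡ = mk⇔ (λ _ → 𝒴≅model γ≡) (λ _ → ∈T) , contradiction ∈T
      where ∈T = Equivalence.from ∈⇔triangle (cong isTriangle γ≡)
    by-cycle (square j) γ≡ =
      mk⇔ (λ ∈T → contradiction ∈T ∉T) (λ ≅Conc₄¹ → contradiction ≅Conc₄¹ (square≇Conc₄¹ c j γ≡)) ,
      λ _ → 𝒴≅model γ≡
      where
      ∉T : without c ∉ omissions T
      ∉T ∈T = case subst (λ γ → isTriangle γ ≡ true) γ≡ (Equivalence.to ∈⇔triangle ∈T) of λ ()

  4-subset-classified : ∀ R → ∣ R ∣ ≡ 4 → Classified R
  4-subset-classified R ∣R∣≡4 = classified (∣R∣≡4⇒≡without R ∣R∣≡4)
    where
    classified : ∀ {R} → ∃ (λ c → R ≡ without c) → Classified R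
    classified (c , refl) = without-classified c

theorem2 : (𝒳 : RawDPS 5) → IsDivPointSet 𝒳 → ∣ P 𝒳 ∣ ≡ 5
    → L1 𝒳 → L2 𝒳 → L3 𝒳
    → Σ (List (Subset 5)) λ 𝒞 →
        Unique 𝒞
        × All (λ R → R ⊆ P 𝒳 × ∣ R ∣ ≡ 4) 𝒞
        × (∀ (R : Subset 5) → R ⊆ P 𝒳 → ∣ R ∣ ≡ 4 →
             (R ∈ 𝒞 ⇔ Isomorphic (sub 𝒳 R) Conc₄¹)
             × (R ∉ 𝒞 → Isomorphic (sub 𝒳 R) Conv₄))
        × (length 𝒞 ≡ 4 ⊎ length 𝒞 ≡ 2 ⊎ length 𝒞 ≡ 0)
theorem2 𝒳 isDPS ∣P∣≡5 l1 _ l3 =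
  omissions T ,
  omissions-unique T ,
  All.tabulate (λ {R} R∈ → ⊆P R , ∈omissions⇒∣∣≡4 T R∈) ,
  (λ R _ → 4-subset-classified R) ,
  omissions-length T triangleOmissions-even
  where
  open FivePointDivSet 𝒳 isDPS ∣P∣≡5 l1 l3
  T = triangleOmissions
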